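{- For every positive integer $n$, the following identity holds in the ring of Laurent polynomials $\mathbb{Z}[x_1^{\pm1},\ldots,x_n^{\pm1}]$: $$ x_1 \cdots x_n \sum_{k=1}^n (-1)^{k-1}(1-x_k)\, x_k^{ -1} \prod_{\substack{1\le i\le n\\ i \neq k}} (1-x_i x_k) \prod_{\substack{1\leq i < j \leq n \\ i,j \neq k}}(x_j - x_i) = (1 - x_1 \cdots x_n)\prod_{1\leq i < j \leq n}(x_j-x_i). $$
   Context: Empty products are equal to $1$. -}

module Defs where

open import Algebra.Bundles using (CommutativeRing)
open import Data.Nat using (ℕ; zero; suc)
open import Data.Fin using (Fin; zero; suc)
open import Relation.Nullary using (Dec; yes; no)

module RingOps {c ℓ} (R : CommutativeRing c ℓ) where
  open CommutativeRing R using (Carrier; _+_; _*_; -_; 0#; 1#)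

  prod : ∀ {n} → (Fin n → Carrier) → Carrier
  prod {zero} f = 1#
  prod {suc n} f = f zero * prod (λ i → f (suc i))

  sum : ∀ {n} → (Fin n → Carrier) → Carrier
  sum {zero} f = 0#
  sum {suc n} f = f zero + sum (λ i → f (suc i))

  sign : ℕ → Carrier
  sign zero = 1#
  sign (suc m) = - sign m

  when : ∀ {p} {P : Set p} → Dec P → Carrier → Carrier
  when (yes _) a = a
  when (no _) a = 1#

module Submission where

-- Multiplying the k-th summand by x₁ ⋯ xₙ cancels x_k⁻¹ and leaves
--   ± (1 − x_k) ∏_{i≠k} (1 − x_i x_k) · ∏_{i≠k} x_i · V_k,
-- V_k being the Vandermonde product of the x_i with x_k removed. Let q be the quotient of
-- ∏_i (1 − x_i t) by 1 + t, a polynomial of degree < n; evaluating at t = x_k gives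
--   (1 − x_k) ∏_{i≠k} (1 − x_i x_k) = q(x_k) + ∏_{i≠k} (1 + x_i).
-- Lagrange interpolation of q at the nodes x_i turns Σ_k ± q(x_k) ∏_{i≠k} x_i V_k into q(0) V,
-- and two Laplace expansions of V turn the remaining sum into (∏ (1 + x_i) − ∏ x_i) V. Since
-- q(0) + ∏ (1 + x_i) is the value 1 of ∏ (1 − x_i t) at t = 0, the total is (1 − x₁ ⋯ xₙ) V.
-- All of this holds in any commutative ring: no division is needed, and "degree < d" is
-- expressed by the vanishing of alternants.

open import Defs
open import Algebra.Bundles using (CommutativeRing)
open import Algebra.Solver.Ring.AlmostCommutativeRing using (_-Raw-AlmostCommutative⟶_; fromCommutativeRing)
open import Data.Fin using (Fin; zero; suc; toℕ; punchIn; _<_; _<?_)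
open import Data.Fin.Properties using (_≟_; punchInᵢ≢i; punchIn-mono-≤; punchIn-cancel-≤)
open import Data.Integer as ℤ using (ℤ; +_; -[1+_]; _⊖_; 0ℤ; 1ℤ)
import Data.Integer.Properties as ℤ
open import Data.Maybe using (Maybe; just; nothing)
open import Data.Nat as ℕ using (ℕ; zero; suc; _≤_)
import Data.Nat.Properties as ℕ
open import Data.Product using (_×_; _,_; proj₁)
import Data.Sign as Sign
open import Data.Vec.Functional using (removeAt; _∷_)
open import Function using (_∘_)
open import Relation.Binary.PropositionalEquality as ≡ using (_≡_)
open import Relation.Nullary using (¬_; Dec; yes; no; contradiction)
open import Relation.Nullary.Decidable using (_×-dec_; ¬?)

punchIn-mono-< : ∀ {n} (k : Fin (suc n)) {i j : Fin n} → i < j → punchIn k i < punchIn k j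
punchIn-mono-< k {i} {j} i<j = ℕ.≰⇒> (ℕ.<⇒≱ i<j ∘ punchIn-cancel-≤ k j i)

punchIn-cancel-< : ∀ {n} (k : Fin (suc n)) {i j : Fin n} → punchIn k i < punchIn k j → i < j
punchIn-cancel-< k {i} {j} i<j = ℕ.≰⇒> (ℕ.<⇒≱ i<j ∘ punchIn-mono-≤ k j i)

module IntegerCoefficients {c ℓ} (R : CommutativeRing c ℓ) where
  open CommutativeRing R
  open import Algebra.Properties.Ring ring
    using (-‿involutive; -‿distribˡ-*; -‿distribʳ-*; -‿+-comm; -0#≈0#)
  open import Algebra.Properties.Semiring.Mult.TCOptimised semiring
    using (×-homo-+; ×1-homo-*) renaming (_×_ to _×′_)
  open import Algebra.Properties.CommutativeSemigroup +-commutativeSemigroup using (interchange)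
  open import Relation.Binary.Reasoning.Setoid setoid

  fromℤ : ℤ → Carrier
  fromℤ (+ n) = n ×′ 1#
  fromℤ -[1+ n ] = - (suc n ×′ 1#)

  fromℤ-‿homo : ∀ i → fromℤ (ℤ.- i) ≈ - fromℤ i
  fromℤ-‿homo (+ zero) = sym -0#≈0#
  fromℤ-‿homo (+ suc n) = refl
  fromℤ-‿homo -[1+ n ] = sym (-‿involutive _)

  fromℤ-⊖ : ∀ m n → fromℤ (m ⊖ n) ≈ m ×′ 1# + - (n ×′ 1#)
  fromℤ-⊖ m zero = begin
    m ×′ 1#          ≈⟨ +-identityʳ _ ⟨
    m ×′ 1# + 0#     ≈⟨ +-congˡ -0#≈0# ⟨
    m ×′ 1# + - 0#   ∎
  fromℤ-⊖ zero (suc n) = sym (+-identityˡ _)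
  fromℤ-⊖ (suc m) (suc n) = begin
    fromℤ (suc m ⊖ suc n)                    ≡⟨ ≡.cong fromℤ (ℤ.[1+m]⊖[1+n]≡m⊖n m n) ⟩
    fromℤ (m ⊖ n)                            ≈⟨ fromℤ-⊖ m n ⟩
    m ×′ 1# + - (n ×′ 1#)                    ≈⟨ +-identityˡ _ ⟨
    0# + (m ×′ 1# + - (n ×′ 1#))             ≈⟨ +-congʳ (-‿inverseʳ 1#) ⟨
    (1# + - 1#) + (m ×′ 1# + - (n ×′ 1#))    ≈⟨ interchange _ _ _ _ ⟩
    (1# + m ×′ 1#) + (- 1# + - (n ×′ 1#))    ≈⟨ +-cong (sym (×-homo-+ 1# 1 m)) (-‿+-comm 1# _) ⟩
    suc m ×′ 1# + - (1# + n ×′ 1#)           ≈⟨ +-congˡ (-‿cong (×-homo-+ 1# 1 n)) ⟨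
    suc m ×′ 1# + - (suc n ×′ 1#)            ∎

  fromℤ-+-homo : ∀ i j → fromℤ (i ℤ.+ j) ≈ fromℤ i + fromℤ j
  fromℤ-+-homo (+ m) (+ n) = ×-homo-+ 1# m n
  fromℤ-+-homo (+ m) -[1+ n ] = fromℤ-⊖ m (suc n)
  fromℤ-+-homo -[1+ m ] (+ n) = trans (fromℤ-⊖ n (suc m)) (+-comm _ _)
  fromℤ-+-homo -[1+ m ] -[1+ n ] = begin
    - (suc (suc (m ℕ.+ n)) ×′ 1#)        ≡⟨ ≡.cong (λ k → - (suc k ×′ 1#)) (ℕ.+-suc m n) ⟨
    - ((suc m ℕ.+ suc n) ×′ 1#)          ≈⟨ -‿cong (×-homo-+ 1# (suc m) (suc n)) ⟩
    - (suc m ×′ 1# + suc n ×′ 1#)        ≈⟨ -‿+-comm _ _ ⟨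
    - (suc m ×′ 1#) + - (suc n ×′ 1#)    ∎

  fromℤ-*-homo : ∀ i j → fromℤ (i ℤ.* j) ≈ fromℤ i * fromℤ j
  fromℤ-*-homo (+ m) (+ n) = begin
    fromℤ (Sign.+ ℤ.◃ (m ℕ.* n))         ≡⟨ ≡.cong fromℤ (ℤ.+◃n≡+n (m ℕ.* n)) ⟩
    (m ℕ.* n) ×′ 1#                      ≈⟨ ×1-homo-* m n ⟩
    m ×′ 1# * n ×′ 1#                    ∎
  fromℤ-*-homo (+ m) -[1+ n ] = begin
    fromℤ (Sign.- ℤ.◃ (m ℕ.* suc n))     ≡⟨ ≡.cong fromℤ (ℤ.-◃n≡-n (m ℕ.* suc n)) ⟩
    fromℤ (ℤ.- + (m ℕ.* suc n))          ≈⟨ fromℤ-‿homo (+ (m ℕ.* suc n)) ⟩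
    - ((m ℕ.* suc n) ×′ 1#)              ≈⟨ -‿cong (×1-homo-* m (suc n)) ⟩
    - (m ×′ 1# * suc n ×′ 1#)            ≈⟨ -‿distribʳ-* _ _ ⟩
    m ×′ 1# * - (suc n ×′ 1#)            ∎
  fromℤ-*-homo -[1+ m ] (+ n) = begin
    fromℤ (Sign.- ℤ.◃ (suc m ℕ.* n))     ≡⟨ ≡.cong fromℤ (ℤ.-◃n≡-n (suc m ℕ.* n)) ⟩
    fromℤ (ℤ.- + (suc m ℕ.* n))          ≈⟨ fromℤ-‿homo (+ (suc m ℕ.* n)) ⟩
    - ((suc m ℕ.* n) ×′ 1#)              ≈⟨ -‿cong (×1-homo-* (suc m) n) ⟩
    - (suc m ×′ 1# * n ×′ 1#)            ≈⟨ -‿distribˡ-* _ _ ⟩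
    - (suc m ×′ 1#) * n ×′ 1#            ∎
  fromℤ-*-homo -[1+ m ] -[1+ n ] = begin
    (suc m ℕ.* suc n) ×′ 1#              ≈⟨ ×1-homo-* (suc m) (suc n) ⟩
    suc m ×′ 1# * suc n ×′ 1#            ≈⟨ -‿involutive _ ⟨
    - - (suc m ×′ 1# * suc n ×′ 1#)      ≈⟨ -‿cong (-‿distribˡ-* _ _) ⟩
    - (- (suc m ×′ 1#) * suc n ×′ 1#)    ≈⟨ -‿distribʳ-* _ _ ⟩
    - (suc m ×′ 1#) * - (suc n ×′ 1#)    ∎

  homomorphism : ℤ.+-*-rawRing -Raw-AlmostCommutative⟶ fromCommutativeRing R
  homomorphism = record
    { ⟦_⟧    = fromℤ
    ; +-homo = fromℤ-+-homo
    ; *-homo = fromℤ-*-homo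
    ; -‿homo = fromℤ-‿homo
    ; 0-homo = refl
    ; 1-homo = refl
    }

  fromℤ-≟ : ∀ i j → Maybe (fromℤ i ≈ fromℤ j)
  fromℤ-≟ i j with i ℤ.≟ j
  ... | yes ≡.refl = just refl
  ... | no _       = nothing

  open import Algebra.Solver.Ring ℤ.+-*-rawRing (fromCommutativeRing R) homomorphism fromℤ-≟
    public using (solve; _:=_; _:+_; _:*_; :-_; con)

module BigOperators {c ℓ} (R : CommutativeRing c ℓ) where
  open CommutativeRing R hiding (zero)
  open RingOps R
  open import Algebra.Properties.Ring ring using (-‿+-comm; -0#≈0#)
  open import Algebra.Properties.CommutativeSemigroup +-commutativeSemigroup using (interchange)
  open import Algebra.Properties.CommutativeSemigroup *-commutativeSemigroup using (x∙yz≈y∙xz)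

  prod-cong : ∀ {n} {f g : Fin n → Carrier} → (∀ i → f i ≈ g i) → prod f ≈ prod g
  prod-cong {zero} f≈g = refl
  prod-cong {suc n} f≈g = *-cong (f≈g zero) (prod-cong (f≈g ∘ suc))

  sum-cong : ∀ {n} {f g : Fin n → Carrier} → (∀ i → f i ≈ g i) → sum f ≈ sum g
  sum-cong {zero} f≈g = refl
  sum-cong {suc n} f≈g = +-cong (f≈g zero) (sum-cong (f≈g ∘ suc))

  prod-1 : ∀ {n} {f : Fin n → Carrier} → (∀ i → f i ≈ 1#) → prod f ≈ 1#
  prod-1 {zero} f≈1 = refl
  prod-1 {suc n} f≈1 = trans (*-cong (f≈1 zero) (prod-1 (f≈1 ∘ suc))) (*-identityˡ 1#)

  sum-+ : ∀ {n} (f g : Fin n → Carrier) → sum (λ i → f i + g i) ≈ sum f + sum g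
  sum-+ {zero} f g = sym (+-identityˡ 0#)
  sum-+ {suc n} f g = trans (+-congˡ (sum-+ (f ∘ suc) (g ∘ suc))) (interchange _ _ _ _)

  sum-*ˡ : ∀ {n} a (f : Fin n → Carrier) → sum (λ i → a * f i) ≈ a * sum f
  sum-*ˡ {zero} a f = sym (zeroʳ a)
  sum-*ˡ {suc n} a f = trans (+-congˡ (sum-*ˡ a (f ∘ suc))) (sym (distribˡ a _ _))

  sum-neg : ∀ {n} (f : Fin n → Carrier) → sum (λ i → - f i) ≈ - sum f
  sum-neg {zero} f = sym -0#≈0#
  sum-neg {suc n} f = trans (+-congˡ (sum-neg (f ∘ suc))) (-‿+-comm _ _)

  sum-linear : ∀ {n} a b (f g : Fin n → Carrier) →
    sum (λ i → a * f i + - (b * g i)) ≈ a * sum f + - (b * sum g)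
  sum-linear a b f g = trans (sum-+ (λ i → a * f i) (λ i → - (b * g i)))
    (+-cong (sum-*ˡ a f) (trans (sum-neg (λ i → b * g i)) (-‿cong (sum-*ˡ b g))))

  prod-removeAt : ∀ {n} (f : Fin (suc n) → Carrier) k → prod f ≈ f k * prod (removeAt f k)
  prod-removeAt f zero = refl
  prod-removeAt {suc n} f (suc k) =
    trans (*-congˡ (prod-removeAt (f ∘ suc) k)) (x∙yz≈y∙xz _ _ _)

  prod-removeAt-1 : ∀ {n} (f : Fin (suc n) → Carrier) k → f k ≈ 1# → prod f ≈ prod (removeAt f k)
  prod-removeAt-1 f k fk≈1 = trans (prod-removeAt f k) (trans (*-congʳ fk≈1) (*-identityˡ _))

  when-true : ∀ {p} {P : Set p} (P? : Dec P) {a} → P → when P? a ≡ a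
  when-true (yes _) _ = ≡.refl
  when-true (no ¬p) p = contradiction p ¬p

  when-false : ∀ {p} {P : Set p} (P? : Dec P) {a} → ¬ P → when P? a ≡ 1#
  when-false (yes p) ¬p = contradiction p ¬p
  when-false (no _) _ = ≡.refl

  when-⇔ : ∀ {p q} {P : Set p} {Q : Set q} (P? : Dec P) (Q? : Dec Q) {a} →
    (P → Q) → (Q → P) → when P? a ≡ when Q? a
  when-⇔ P? (yes q) _ Q→P = when-true P? (Q→P q)
  when-⇔ P? (no ¬q) P→Q _ = when-false P? (¬q ∘ P→Q)

  prod-when-≢ : ∀ {n} (f : Fin (suc n) → Carrier) k →
    prod (λ i → when (¬? (i ≟ k)) (f i)) ≈ prod (removeAt f k)
  prod-when-≢ f k = trans
    (prod-removeAt-1 (λ i → when (¬? (i ≟ k)) (f i)) k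
      (reflexive (when-false (¬? (k ≟ k)) (λ k≢k → k≢k ≡.refl))))
    (prod-cong (λ i → reflexive (when-true (¬? (punchIn k i ≟ k)) (punchInᵢ≢i k i))))

module Vandermonde {c ℓ} (R : CommutativeRing c ℓ) where
  open CommutativeRing R hiding (zero)
  open RingOps R
  open BigOperators R
  open IntegerCoefficients R
  open import Relation.Binary.Reasoning.Setoid setoid

  vandermonde : ∀ {n} → (Fin n → Carrier) → Carrier
  vandermonde {zero} y = 1#
  vandermonde {suc n} y = prod (λ j → y (suc j) + - y zero) * vandermonde (y ∘ suc)

  vandermonde-when : ∀ {n} (y : Fin n → Carrier) →
    prod (λ i → prod (λ j → when (i <? j) (y j + - y i))) ≈ vandermonde y
  vandermonde-when {zero} y = refl
  vandermonde-when {suc n} y =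
    *-cong (*-identityˡ _) (trans (prod-cong laterRow) (vandermonde-when (y ∘ suc)))
    where
    laterRow : ∀ i → prod (λ j → when (suc i <? j) (y j + - y (suc i)))
                   ≈ prod (λ j → when (i <? j) (y (suc j) + - y (suc i)))
    laterRow i = trans (*-identityˡ _) (prod-cong (λ j →
      reflexive (when-⇔ (suc i <? suc j) (i <? j) {y (suc j) + - y (suc i)} ℕ.s≤s⁻¹ ℕ.s≤s)))

  vandermonde-removeAt-when : ∀ {n} (y : Fin (suc n) → Carrier) k →
    prod (λ i → prod (λ j → when ((i <? j) ×-dec (¬? (i ≟ k) ×-dec ¬? (j ≟ k))) (y j + - y i)))
      ≈ vandermonde (removeAt y k)
  vandermonde-removeAt-when {n} y k = begin
    prod (λ i → prod (entry i))                                  ≈⟨ dropRow ⟩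
    prod (λ i → prod (entry (punchIn k i)))                      ≈⟨ prod-cong dropColumn ⟩
    prod (λ i → prod (λ j → entry (punchIn k i) (punchIn k j)))  ≈⟨ prod-cong (prod-cong ∘ reindex) ⟩
    prod (λ i → prod (λ j → when (i <? j) (y′ j + - y′ i)))      ≈⟨ vandermonde-when y′ ⟩
    vandermonde y′                                               ∎
    where
    y′ = removeAt y k
    condition : (i j : Fin (suc n)) → Dec (i < j × ¬ i ≡ k × ¬ j ≡ k)
    condition i j = (i <? j) ×-dec (¬? (i ≟ k) ×-dec ¬? (j ≟ k))
    entry : Fin (suc n) → Fin (suc n) → Carrier
    entry i j = when (condition i j) (y j + - y i)
    dropRow : prod (λ i → prod (entry i)) ≈ prod (λ i → prod (entry (punchIn k i)))
    dropRow = prod-removeAt-1 (λ i → prod (entry i)) k (prod-1 (λ j →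
      reflexive (when-false (condition k j) {y j + - y k} λ (_ , k≢k , _) → k≢k ≡.refl)))
    dropColumn : ∀ i → prod (entry (punchIn k i)) ≈ prod (λ j → entry (punchIn k i) (punchIn k j))
    dropColumn i = prod-removeAt-1 (entry (punchIn k i)) k
      (reflexive (when-false (condition (punchIn k i) k) λ (_ , _ , k≢k) → k≢k ≡.refl))
    reindex : ∀ i j → entry (punchIn k i) (punchIn k j) ≈ when (i <? j) (y′ j + - y′ i)
    reindex i j = reflexive (when-⇔ (condition (punchIn k i) (punchIn k j)) (i <? j)
      (punchIn-cancel-< k ∘ proj₁) (λ i<j → punchIn-mono-< k i<j , punchInᵢ≢i k i , punchInᵢ≢i k j))

  -- Divided by V(y), this is Lagrange interpolation of the constant 1:
  -- Σₖ ∏_{j≠k} (y_j − t) / (y_j − y_k) = 1.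
  vandermonde-expansion : ∀ {n} (y : Fin (suc n) → Carrier) t →
    sum (λ k → sign (toℕ k) * prod (removeAt (λ j → y j + - t) k) * vandermonde (removeAt y k))
      ≈ vandermonde y
  vandermonde-expansion {zero} y t = trans (+-identityʳ _) (*-identityʳ _)
  vandermonde-expansion {suc n} y t = begin
    1# * Pt * V u + sum (λ k → - s k * ((y zero + - t) * Et k) * (E₀ k * Vₖ k))
      ≈⟨ +-congˡ (sum-cong split) ⟩
    1# * Pt * V u + sum (λ k → P₀ * (s k * Et k * Vₖ k) + - (Pt * (s k * E₀ k * Vₖ k)))
      ≈⟨ +-congˡ (sum-linear P₀ Pt (λ k → s k * Et k * Vₖ k) (λ k → s k * E₀ k * Vₖ k)) ⟩
    1# * Pt * V u + (P₀ * sum (λ k → s k * Et k * Vₖ k) + - (Pt * sum (λ k → s k * E₀ k * Vₖ k)))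
      ≈⟨ +-congˡ (+-cong (*-congˡ (vandermonde-expansion u t))
                         (-‿cong (*-congˡ (vandermonde-expansion u (y zero))))) ⟩
    1# * Pt * V u + (P₀ * V u + - (Pt * V u))
      ≈⟨ solve 3 (λ v a b → con 1ℤ :* a :* v :+ (b :* v :+ :- (a :* v)) := b :* v) refl (V u) Pt P₀ ⟩
    P₀ * V u ∎
    where
    V = vandermonde
    u = y ∘ suc
    Pt = prod (λ j → u j + - t)
    P₀ = prod (λ j → u j + - y zero)
    s Et E₀ Vₖ : Fin (suc n) → Carrier
    s k = sign (toℕ k)
    Et = prod ∘ removeAt (λ j → u j + - t)
    E₀ = prod ∘ removeAt (λ j → u j + - y zero)
    Vₖ = V ∘ removeAt u
    -- y₀ − t = (uₖ − t) − (uₖ − y₀) splits each term into terms of the two smaller expansions.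
    split : ∀ k → - s k * ((y zero + - t) * Et k) * (E₀ k * Vₖ k)
                  ≈ P₀ * (s k * Et k * Vₖ k) + - (Pt * (s k * E₀ k * Vₖ k))
    split k = begin
      - s k * ((y zero + - t) * Et k) * (E₀ k * Vₖ k)
        ≈⟨ solve 7 (λ s e₀ v y₀ t et uₖ →
             :- s :* ((y₀ :+ :- t) :* et) :* (e₀ :* v)
               := ((uₖ :+ :- y₀) :* e₀) :* (s :* et :* v) :+ :- (((uₖ :+ :- t) :* et) :* (s :* e₀ :* v)))
             refl (s k) (E₀ k) (Vₖ k) (y zero) t (Et k) (u k) ⟩
      ((u k + - y zero) * E₀ k) * (s k * Et k * Vₖ k) + - (((u k + - t) * Et k) * (s k * E₀ k * Vₖ k))
        ≈⟨ +-cong (*-congʳ (prod-removeAt (λ j → u j + - y zero) k))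
                  (-‿cong (*-congʳ (prod-removeAt (λ j → u j + - t) k))) ⟨
      P₀ * (s k * Et k * Vₖ k) + - (Pt * (s k * E₀ k * Vₖ k)) ∎

module Alternant {c ℓ} (R : CommutativeRing c ℓ) where
  open CommutativeRing R hiding (zero)
  open RingOps R
  open BigOperators R
  open Vandermonde R
  open IntegerCoefficients R
  open import Algebra.Properties.Group +-group using (x∙y⁻¹≈ε⇒x≈y; x≈y⇒x∙y⁻¹≈ε)
  open import Relation.Binary.Reasoning.Setoid setoid

  -- Up to sign, the determinant with rows 1, t, …, tⁿ⁻¹, g(t) at the nodes y, expanded along its
  -- last row; it is V(y) times the top divided difference of g.
  alternant : ∀ {n} → (Carrier → Carrier) → (Fin (suc n) → Carrier) → Carrier
  alternant g y = sum (λ k → sign (toℕ k) * g (y k) * vandermonde (removeAt y k))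

  -- g behaves as a polynomial function of degree < d: its alternants at more than d nodes vanish.
  DegreeBelow : ℕ → (Carrier → Carrier) → Set _
  DegreeBelow d g = ∀ {n} (y : Fin (suc n) → Carrier) → d ≤ n → alternant g y ≈ 0#

  alternant-uncons : ∀ {n} g (y : Fin (suc (suc n)) → Carrier) →
    alternant g y
      ≈ g (y zero) * vandermonde (y ∘ suc)
        + - sum (λ k → sign (toℕ k) * g (y (suc k)) * prod (removeAt (λ j → y (suc j) + - y zero) k)
                       * vandermonde (removeAt (y ∘ suc) k))
  alternant-uncons g y =
    +-cong (*-congʳ (*-identityˡ _)) (trans (sum-cong term) (sum-neg (λ k → s k * g (y (suc k)) * E k * V k)))
    where
    s E V : Fin _ → Carrier
    s k = sign (toℕ k)
    E = prod ∘ removeAt (λ j → y (suc j) + - y zero)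
    V = vandermonde ∘ removeAt (y ∘ suc)
    term : ∀ k → - s k * g (y (suc k)) * (E k * V k) ≈ - (s k * g (y (suc k)) * E k * V k)
    term k = solve 4 (λ s a e v → :- s :* a :* (e :* v) := :- (s :* a :* e :* v))
                     refl (s k) (g (y (suc k))) (E k) (V k)

  -- The alternant of g at the n + 2 nodes t, x₀, …, xₙ vanishes.
  lagrange-interpolation : ∀ {n g} → DegreeBelow (suc n) g → (x : Fin (suc n) → Carrier) → ∀ t →
    sum (λ k → sign (toℕ k) * g (x k) * prod (removeAt (λ j → x j + - t) k) * vandermonde (removeAt x k))
      ≈ g t * vandermonde x
  lagrange-interpolation {g = g} deg x t =
    sym (x∙y⁻¹≈ε⇒x≈y _ _ (trans (sym (alternant-uncons g (t ∷ x))) (deg (t ∷ x) ℕ.≤-refl)))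

  alternant-zero : ∀ {n} (y : Fin (suc n) → Carrier) → alternant (λ _ → 0#) y ≈ 0#
  alternant-zero y = begin
    sum (λ k → s k * 0# * V k)     ≈⟨ sum-cong (λ k → solve 2 (λ s v → s :* con 0ℤ :* v := con 0ℤ :* (s :* v))
                                                        refl (s k) (V k)) ⟩
    sum (λ k → 0# * (s k * V k))   ≈⟨ sum-*ˡ 0# (λ k → s k * V k) ⟩
    0# * sum (λ k → s k * V k)     ≈⟨ zeroˡ _ ⟩
    0#                             ∎
    where
    s V : Fin _ → Carrier
    s k = sign (toℕ k)
    V = vandermonde ∘ removeAt y

  alternant-const : ∀ {n} a (y : Fin (suc (suc n)) → Carrier) → alternant (λ _ → a) y ≈ 0#
  alternant-const a y = trans (alternant-uncons (λ _ → a) y) (x≈y⇒x∙y⁻¹≈ε (sym (begin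
    sum (λ k → s k * a * E k * V k)
      ≈⟨ sum-cong (λ k → solve 4 (λ s a e v → s :* a :* e :* v := a :* (s :* e :* v)) refl (s k) a (E k) (V k)) ⟩
    sum (λ k → a * (s k * E k * V k))
      ≈⟨ sum-*ˡ a (λ k → s k * E k * V k) ⟩
    a * sum (λ k → s k * E k * V k)
      ≈⟨ *-congˡ (vandermonde-expansion (y ∘ suc) (y zero)) ⟩
    a * vandermonde (y ∘ suc) ∎)))
    where
    s E V : Fin _ → Carrier
    s k = sign (toℕ k)
    E = prod ∘ removeAt (λ j → y (suc j) + - y zero)
    V = vandermonde ∘ removeAt (y ∘ suc)

  alternant-linear* : ∀ {n} a b g (y : Fin (suc n) → Carrier) →
    alternant (λ t → (a + b * t) * g t) y
      ≈ (a + b * y zero) * alternant g y + b * alternant (λ t → (t + - y zero) * g t) y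
  alternant-linear* a b g y = begin
    alternant (λ t → (a + b * t) * g t) y
      ≈⟨ sum-cong split ⟩
    sum (λ k → (a + b * y zero) * f k + b * h k)
      ≈⟨ sum-+ (λ k → (a + b * y zero) * f k) (λ k → b * h k) ⟩
    sum (λ k → (a + b * y zero) * f k) + sum (λ k → b * h k)
      ≈⟨ +-cong (sum-*ˡ (a + b * y zero) f) (sum-*ˡ b h) ⟩
    (a + b * y zero) * alternant g y + b * alternant (λ t → (t + - y zero) * g t) y ∎
    where
    s V f h : Fin _ → Carrier
    s k = sign (toℕ k)
    V = vandermonde ∘ removeAt y
    f k = s k * g (y k) * V k
    h k = s k * ((y k + - y zero) * g (y k)) * V k
    split : ∀ k → s k * ((a + b * y k) * g (y k)) * V k ≈ (a + b * y zero) * f k + b * h k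
    split k = solve 7 (λ a b s yₖ y₀ gₖ v →
      s :* ((a :+ b :* yₖ) :* gₖ) :* v
        := (a :+ b :* y₀) :* (s :* gₖ :* v) :+ b :* (s :* ((yₖ :+ :- y₀) :* gₖ) :* v))
      refl a b (s k) (y k) (y zero) (g (y k)) (V k)

  alternant-*-node : ∀ {n} g (y : Fin (suc (suc n)) → Carrier) →
    alternant (λ t → (t + - y zero) * g t) y
      ≈ - (prod (λ j → y (suc j) + - y zero) * alternant g (y ∘ suc))
  alternant-*-node g y = begin
    alternant (λ t → (t + - y zero) * g t) y
      ≈⟨ alternant-uncons (λ t → (t + - y zero) * g t) y ⟩
    (y zero + - y zero) * g (y zero) * vandermonde u
      + - sum (λ k → s k * ((u k + - y zero) * g (u k)) * E k * V k)
      ≈⟨ +-cong (trans (*-congʳ (trans (*-congʳ (-‿inverseʳ _)) (zeroˡ _))) (zeroˡ _))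
                (-‿cong (sum-cong term)) ⟩
    0# + - sum (λ k → P * (s k * g (u k) * V k))
      ≈⟨ +-identityˡ _ ⟩
    - sum (λ k → P * (s k * g (u k) * V k))
      ≈⟨ -‿cong (sum-*ˡ P (λ k → s k * g (u k) * V k)) ⟩
    - (P * alternant g u) ∎
    where
    u = y ∘ suc
    P = prod (λ j → u j + - y zero)
    s E V : Fin _ → Carrier
    s k = sign (toℕ k)
    E = prod ∘ removeAt (λ j → u j + - y zero)
    V = vandermonde ∘ removeAt u
    term : ∀ k → s k * ((u k + - y zero) * g (u k)) * E k * V k ≈ P * (s k * g (u k) * V k)
    term k = begin
      s k * ((u k + - y zero) * g (u k)) * E k * V k
        ≈⟨ solve 5 (λ s d a e v → s :* (d :* a) :* e :* v := (d :* e) :* (s :* a :* v))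
                   refl (s k) (u k + - y zero) (g (u k)) (E k) (V k) ⟩
      ((u k + - y zero) * E k) * (s k * g (u k) * V k)
        ≈⟨ *-congʳ (prod-removeAt (λ j → u j + - y zero) k) ⟨
      P * (s k * g (u k) * V k) ∎

  DegreeBelow-mono : ∀ {d e g} → d ≤ e → DegreeBelow d g → DegreeBelow e g
  DegreeBelow-mono d≤e deg y e≤n = deg y (ℕ.≤-trans d≤e e≤n)

  DegreeBelow-zero : DegreeBelow 0 (λ _ → 0#)
  DegreeBelow-zero y _ = alternant-zero y

  DegreeBelow-const : ∀ a → DegreeBelow 1 (λ _ → a)
  DegreeBelow-const a {suc n} y _ = alternant-const a y

  DegreeBelow-+ : ∀ {d f g} → DegreeBelow d f → DegreeBelow d g → DegreeBelow d (λ t → f t + g t)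
  DegreeBelow-+ {f = f} {g} deg-f deg-g y d≤n = begin
    alternant (λ t → f t + g t) y
      ≈⟨ sum-cong (λ k → solve 4 (λ s a b v → s :* (a :+ b) :* v := s :* a :* v :+ s :* b :* v)
                                 refl (s k) (f (y k)) (g (y k)) (V k)) ⟩
    sum (λ k → s k * f (y k) * V k + s k * g (y k) * V k)
      ≈⟨ sum-+ (λ k → s k * f (y k) * V k) (λ k → s k * g (y k) * V k) ⟩
    alternant f y + alternant g y
      ≈⟨ +-cong (deg-f y d≤n) (deg-g y d≤n) ⟩
    0# + 0#
      ≈⟨ +-identityˡ 0# ⟩
    0# ∎
    where
    s V : Fin _ → Carrier
    s k = sign (toℕ k)
    V = vandermonde ∘ removeAt y

  DegreeBelow-linear* : ∀ {d g} a b → DegreeBelow d g → DegreeBelow (suc d) (λ t → (a + b * t) * g t)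
  DegreeBelow-linear* {g = g} a b deg {suc n} y (ℕ.s≤s d≤n) = begin
    alternant (λ t → (a + b * t) * g t) y
      ≈⟨ alternant-linear* a b g y ⟩
    (a + b * y zero) * alternant g y + b * alternant (λ t → (t + - y zero) * g t) y
      ≈⟨ +-cong (*-congˡ (deg y (ℕ.m≤n⇒m≤1+n d≤n))) (*-congˡ (alternant-*-node g y)) ⟩
    (a + b * y zero) * 0# + b * - (P * alternant g (y ∘ suc))
      ≈⟨ +-congˡ (*-congˡ (-‿cong (*-congˡ (deg (y ∘ suc) d≤n)))) ⟩
    (a + b * y zero) * 0# + b * - (P * 0#)
      ≈⟨ solve 3 (λ c b p → c :* con 0ℤ :+ b :* :- (p :* con 0ℤ) := con 0ℤ)
                 refl (a + b * y zero) b P ⟩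
    0# ∎
    where P = prod (λ j → y (suc j) + - y zero)

module Quotient {c ℓ} (R : CommutativeRing c ℓ) where
  open CommutativeRing R hiding (zero)
  open RingOps R
  open BigOperators R
  open Alternant R
  open IntegerCoefficients R
  open import Algebra.Properties.CommutativeSemigroup *-commutativeSemigroup using (x∙yz≈y∙xz)
  open import Relation.Binary.Reasoning.Setoid setoid

  -- The quotient of ∏ (1 − uᵢ t) by 1 + t, whose remainder is the value ∏ (1 + uᵢ) at t = −1.
  quotient : ∀ {n} → (Fin n → Carrier) → Carrier → Carrier
  quotient {zero} u t = 0#
  quotient {suc n} u t = (1# + - u zero * t) * quotient (u ∘ suc) t + - (u zero * prod (λ i → 1# + u (suc i)))

  quotient-spec : ∀ {n} (u : Fin n → Carrier) t →
    (1# + t) * quotient u t + prod (λ i → 1# + u i) ≈ prod (λ i → 1# + - (u i * t))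
  quotient-spec {zero} u t = solve 1 (λ t → (con 1ℤ :+ t) :* con 0ℤ :+ con 1ℤ := con 1ℤ) refl t
  quotient-spec {suc n} u t = begin
    (1# + t) * ((1# + - u zero * t) * q + - (u zero * P)) + (1# + u zero) * P
      ≈⟨ solve 4 (λ t u₀ q p →
           (con 1ℤ :+ t) :* ((con 1ℤ :+ :- u₀ :* t) :* q :+ :- (u₀ :* p)) :+ (con 1ℤ :+ u₀) :* p
             := (con 1ℤ :+ :- (u₀ :* t)) :* ((con 1ℤ :+ t) :* q :+ p))
           refl t (u zero) q P ⟩
    (1# + - (u zero * t)) * ((1# + t) * q + P)
      ≈⟨ *-congˡ (quotient-spec (u ∘ suc) t) ⟩
    prod (λ i → 1# + - (u i * t)) ∎
    where
    q = quotient (u ∘ suc) t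
    P = prod (λ i → 1# + u (suc i))

  quotient-at-0 : ∀ {n} (u : Fin n → Carrier) → quotient u 0# + prod (λ i → 1# + u i) ≈ 1#
  quotient-at-0 u = begin
    quotient u 0# + P                ≈⟨ +-congʳ (trans (*-congʳ (+-identityʳ 1#)) (*-identityˡ _)) ⟨
    (1# + 0#) * quotient u 0# + P    ≈⟨ quotient-spec u 0# ⟩
    prod (λ i → 1# + - (u i * 0#))   ≈⟨ prod-1 (λ i → solve 1 (λ a → con 1ℤ :+ :- (a :* con 0ℤ) := con 1ℤ)
                                                       refl (u i)) ⟩
    1#                               ∎
    where P = prod (λ i → 1# + u i)

  quotient-degree : ∀ {n} (u : Fin n → Carrier) → DegreeBelow n (quotient u)
  quotient-degree {zero} u = DegreeBelow-zero
  quotient-degree {suc n} u = DegreeBelow-+ {f = λ t → (1# + - u zero * t) * quotient (u ∘ suc) t}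
    (DegreeBelow-linear* {g = quotient (u ∘ suc)} 1# (- u zero) (quotient-degree (u ∘ suc)))
    (DegreeBelow-mono (ℕ.s≤s ℕ.z≤n) (DegreeBelow-const (- (u zero * prod (λ i → 1# + u (suc i))))))

  quotient-at-node : ∀ {n} (x : Fin (suc n) → Carrier) k →
    (1# + - x k) * prod (removeAt (λ i → 1# + - (x i * x k)) k)
      ≈ quotient x (x k) + prod (removeAt (λ i → 1# + x i) k)
  quotient-at-node x zero = begin
    (1# + - x zero) * prod (λ i → 1# + - (x (suc i) * x zero))
      ≈⟨ *-congˡ (quotient-spec (x ∘ suc) (x zero)) ⟨
    (1# + - x zero) * ((1# + x zero) * q + P)
      ≈⟨ solve 3 (λ x₀ q p → (con 1ℤ :+ :- x₀) :* ((con 1ℤ :+ x₀) :* q :+ p)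
                            := (con 1ℤ :+ :- x₀ :* x₀) :* q :+ :- (x₀ :* p) :+ p)
                 refl (x zero) q P ⟩
    quotient x (x zero) + P ∎
    where
    q = quotient (x ∘ suc) (x zero)
    P = prod (λ i → 1# + x (suc i))
  quotient-at-node {suc n} x (suc k) = begin
    (1# + - uₖ) * ((1# + - (x zero * uₖ)) * F)
      ≈⟨ x∙yz≈y∙xz _ _ _ ⟩
    (1# + - (x zero * uₖ)) * ((1# + - uₖ) * F)
      ≈⟨ *-congˡ (quotient-at-node u k) ⟩
    (1# + - (x zero * uₖ)) * (quotient u uₖ + E)
      ≈⟨ solve 4 (λ x₀ uₖ q e →
           (con 1ℤ :+ :- (x₀ :* uₖ)) :* (q :+ e)
             := (con 1ℤ :+ :- x₀ :* uₖ) :* q :+ :- (x₀ :* ((con 1ℤ :+ uₖ) :* e)) :+ (con 1ℤ :+ x₀) :* e)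
           refl (x zero) uₖ (quotient u uₖ) E ⟩
    (1# + - x zero * uₖ) * quotient u uₖ + - (x zero * ((1# + uₖ) * E)) + (1# + x zero) * E
      ≈⟨ +-congʳ (+-congˡ (-‿cong (*-congˡ (prod-removeAt (λ i → 1# + u i) k)))) ⟨
    quotient x uₖ + (1# + x zero) * E ∎
    where
    u = x ∘ suc
    uₖ = u k
    F = prod (removeAt (λ i → 1# + - (u i * uₖ)) k)
    E = prod (removeAt (λ i → 1# + u i) k)

module Identity {c ℓ} (R : CommutativeRing c ℓ) where
  open CommutativeRing R hiding (zero)
  open RingOps R
  open BigOperators R
  open Vandermonde R
  open Alternant R
  open Quotient R
  open IntegerCoefficients R
  open import Relation.Binary.Reasoning.Setoid setoid

  a-0≈a : ∀ a → a + - 0# ≈ a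
  a-0≈a = solve 1 (λ a → a :+ :- con 0ℤ := a) refl

  a-[-1]≈1+a : ∀ a → a + - - 1# ≈ 1# + a
  a-[-1]≈1+a = solve 1 (λ a → a :+ :- (:- con 1ℤ) := con 1ℤ :+ a) refl

  summand : ∀ {n} (x x⁻¹ : Fin n → Carrier) → Fin n → Carrier
  summand x x⁻¹ k = sign (toℕ k) * (1# + - x k) * x⁻¹ k
    * prod (λ i → when (¬? (i ≟ k)) (1# + - (x i * x k)))
    * prod (λ i → prod (λ j → when ((i <? j) ×-dec (¬? (i ≟ k) ×-dec ¬? (j ≟ k))) (x j + - x i)))

  module _ {n} (x : Fin (suc n) → Carrier) where

    E E₁ V : Fin (suc n) → Carrier
    E k = prod (removeAt x k)
    E₁ k = prod (removeAt (λ i → 1# + x i) k)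
    V k = vandermonde (removeAt x k)

    prod-*-summand : ∀ x⁻¹ k → x k * x⁻¹ k ≈ 1# →
      prod x * summand x x⁻¹ k
        ≈ sign (toℕ k) * quotient x (x k) * E k * V k + sign (toℕ k) * E₁ k * E k * V k
    prod-*-summand x⁻¹ k xₖxₖ⁻¹≈1 = begin
      prod x * summand x x⁻¹ k
        ≈⟨ *-cong (prod-removeAt x k)
                  (*-cong (*-congˡ (prod-when-≢ (λ i → 1# + - (x i * x k)) k)) (vandermonde-removeAt-when x k)) ⟩
      (x k * E k) * (s * (1# + - x k) * x⁻¹ k * F * V k)
        ≈⟨ solve 7 (λ xₖ e s a xₖ⁻¹ f v →
             (xₖ :* e) :* (s :* a :* xₖ⁻¹ :* f :* v) := s :* (a :* f) :* e :* v :* (xₖ :* xₖ⁻¹))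
             refl (x k) (E k) s (1# + - x k) (x⁻¹ k) F (V k) ⟩
      s * ((1# + - x k) * F) * E k * V k * (x k * x⁻¹ k)
        ≈⟨ *-cong (*-congʳ (*-congʳ (*-congˡ (quotient-at-node x k)))) xₖxₖ⁻¹≈1 ⟩
      s * (quotient x (x k) + E₁ k) * E k * V k * 1#
        ≈⟨ solve 5 (λ s q e₁ e v →
             s :* (q :+ e₁) :* e :* v :* con 1ℤ := s :* q :* e :* v :+ s :* e₁ :* e :* v)
             refl s (quotient x (x k)) (E₁ k) (E k) (V k) ⟩
      s * quotient x (x k) * E k * V k + s * E₁ k * E k * V k ∎
      where
      s = sign (toℕ k)
      F = prod (removeAt (λ i → 1# + - (x i * x k)) k)

    sum-quotient-terms :
      sum (λ k → sign (toℕ k) * quotient x (x k) * E k * V k) ≈ quotient x 0# * vandermonde x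
    sum-quotient-terms = begin
      sum (λ k → s k * quotient x (x k) * E k * V k)
        ≈⟨ sum-cong shift ⟩
      sum (λ k → s k * quotient x (x k) * E′ k * V k)
        ≈⟨ lagrange-interpolation {g = quotient x} (quotient-degree x) x 0# ⟩
      quotient x 0# * vandermonde x ∎
      where
      s E′ : Fin (suc n) → Carrier
      s k = sign (toℕ k)
      E′ k = prod (removeAt (λ j → x j + - 0#) k)
      shift : ∀ k → s k * quotient x (x k) * E k * V k ≈ s k * quotient x (x k) * E′ k * V k
      shift k = *-congʳ (*-congˡ (prod-cong (λ i → sym (a-0≈a (x (punchIn k i))))))

    sum-product-terms :
      sum (λ k → sign (toℕ k) * E₁ k * E k * V k) ≈ (prod (λ i → 1# + x i) + - prod x) * vandermonde x
    sum-product-terms = begin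
      sum (λ k → s k * E₁ k * E k * V k)
        ≈⟨ sum-cong split ⟨
      sum (λ k → P₁ * (s k * E-0 k * V k) + - (P * (s k * E-1 k * V k)))
        ≈⟨ sum-linear P₁ P (λ k → s k * E-0 k * V k) (λ k → s k * E-1 k * V k) ⟩
      P₁ * sum (λ k → s k * E-0 k * V k) + - (P * sum (λ k → s k * E-1 k * V k))
        ≈⟨ +-cong (*-congˡ (vandermonde-expansion x 0#))
                  (-‿cong (*-congˡ (vandermonde-expansion x (- 1#)))) ⟩
      P₁ * vandermonde x + - (P * vandermonde x)
        ≈⟨ solve 3 (λ p₁ p v → p₁ :* v :+ :- (p :* v) := (p₁ :+ :- p) :* v) refl P₁ P (vandermonde x) ⟩
      (P₁ + - P) * vandermonde x ∎
      where
      P₁ = prod (λ i → 1# + x i)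
      P = prod x
      s E-0 E-1 : Fin (suc n) → Carrier
      s k = sign (toℕ k)
      E-0 k = prod (removeAt (λ j → x j + - 0#) k)
      E-1 k = prod (removeAt (λ j → x j + - - 1#) k)
      -- P₁ Eₖ − P E₁ₖ = ((1 + xₖ) − xₖ) E₁ₖ Eₖ
      split : ∀ k → P₁ * (s k * E-0 k * V k) + - (P * (s k * E-1 k * V k)) ≈ s k * E₁ k * E k * V k
      split k = begin
        P₁ * (s k * E-0 k * V k) + - (P * (s k * E-1 k * V k))
          ≈⟨ +-cong (*-cong (prod-removeAt (λ i → 1# + x i) k)
                            (*-congʳ (*-congˡ (prod-cong λ i → a-0≈a (x (punchIn k i))))))
                    (-‿cong (*-cong (prod-removeAt x k)
                                    (*-congʳ (*-congˡ (prod-cong λ i → a-[-1]≈1+a (x (punchIn k i))))))) ⟩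
        ((1# + x k) * E₁ k) * (s k * E k * V k) + - ((x k * E k) * (s k * E₁ k * V k))
          ≈⟨ solve 5 (λ xₖ e₁ s e v →
               ((con 1ℤ :+ xₖ) :* e₁) :* (s :* e :* v) :+ :- ((xₖ :* e) :* (s :* e₁ :* v)) := s :* e₁ :* e :* v)
               refl (x k) (E₁ k) (s k) (E k) (V k) ⟩
        s k * E₁ k * E k * V k ∎

mainTheorem2 : ∀ {c ℓ} (R : CommutativeRing c ℓ) → let open CommutativeRing R in let open RingOps R in
  (n : ℕ) → 1 ≤ n → (x x⁻¹ : Fin n → Carrier) → (∀ i → x i * x⁻¹ i ≈ 1#) →
  prod x * sum (λ k → sign (toℕ k) * (1# + - x k) * x⁻¹ k
      * prod (λ i → when (¬? (i ≟ k)) (1# + - (x i * x k)))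
      * prod (λ i → prod (λ j → when ((i <? j) ×-dec (¬? (i ≟ k) ×-dec ¬? (j ≟ k))) (x j + - x i))))
    ≈ (1# + - prod x) * prod (λ i → prod (λ j → when (i <? j) (x j + - x i)))
mainTheorem2 R (suc n) _ x x⁻¹ inverse = begin
  prod x * sum (summand x x⁻¹)              ≈⟨ sum-*ˡ (prod x) (summand x x⁻¹) ⟨
  sum (λ k → prod x * summand x x⁻¹ k)     ≈⟨ sum-cong (λ k → prod-*-summand x x⁻¹ k (inverse k)) ⟩
  sum (λ k → A k + B k)                     ≈⟨ sum-+ A B ⟩
  sum A + sum B                             ≈⟨ +-cong (sum-quotient-terms x) (sum-product-terms x) ⟩
  quotient x 0# * Vx + (P₁ + - prod x) * Vx ≈⟨ solve 4 (λ q p₁ p v → q :* v :+ (p₁ :+ :- p) :* v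
                                                                  := (q :+ p₁ :+ :- p) :* v)
                                                       refl (quotient x 0#) P₁ (prod x) Vx ⟩
  (quotient x 0# + P₁ + - prod x) * Vx      ≈⟨ *-congʳ (+-congʳ (quotient-at-0 x)) ⟩
  (1# + - prod x) * Vx                      ≈⟨ *-congˡ (vandermonde-when x) ⟨
  (1# + - prod x) * prod (λ i → prod (λ j → when (i <? j) (x j + - x i))) ∎
  where
  open CommutativeRing R hiding (zero)
  open RingOps R
  open BigOperators R
  open Vandermonde R
  open Quotient R
  open Identity R
  open IntegerCoefficients R
  open import Relation.Binary.Reasoning.Setoid setoid
  Vx = vandermonde x
  P₁ = prod (λ i → 1# + x i)
  A B : Fin (suc n) → Carrier
  A k = sign (toℕ k) * quotient x (x k) * E x k * V x k
  B k = sign (toℕ k) * E₁ x k * E x k * V x k
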